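{- Let $(S_1,\ldots,S_k)$ be an ordered set partition of $\{1,\ldots,n\}$. Then, modulo the span of characteristic functions of polyhedral cones of codimension at least $1$ in $V_0^n$, $$[[S_1,S_2,\ldots,S_k]]+[[S_2,S_3,\ldots,S_k,S_1]]+\cdots+[[S_k,S_1,\ldots,S_{k-1}]]\equiv[[S_1\cup\cdots\cup S_k]];$$ that is, the union of the cyclic block rotations of the plate $[S_1,\ldots,S_k]$ is all of $V_0^n$.
   Context: $V_0^n=\{x\in\mathbb{R}^n:\sum_ix_i=0\}$, $x_S=\sum_{i\in S}x_i$. An ordered set partition of $\{1,\ldots,n\}$ is a sequence of nonempty pairwise disjoint blocks with union $\{1,\ldots,n\}$. The plate $[S_1,\ldots,S_k]$ is $\{x\in V_0^n: x_{S_1}\ge0,\ x_{S_1\cup S_2}\ge0,\ldots,x_{S_1\cup\cdots\cup S_{k-1}}\ge0\}$ and $[[S_1,\ldots,S_k]]$ its characteristic function; $[[S_1\cup\cdots\cup S_k]]=[[\{1,\ldots,n\}]]$ is the characteristic function of $V_0^n$.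
   Formalization: Points of $V_0^n$, including those testing codimension, have rational coordinates instead of real ones, and the normals of the cones and the coefficients of the span are taken over the rationals. -}

module Defs where

open import Data.Nat as ℕ using (ℕ; zero; suc; _∸_; _%_)
open import Data.Fin using (Fin; toℕ; zero; suc)
open import Data.Rational using (ℚ; 0ℚ; 1ℚ; _+_; _*_; _≤_)
open import Data.Rational.Properties using (_≟_; _≤?_)
open import Data.List using (List; []; _∷_; map; upTo)
open import Data.List.Relation.Unary.All using (All)
open import Data.Product using (Σ; ∃; _×_; _,_)
open import Relation.Binary.PropositionalEquality using (_≡_; _≢_)
open import Relation.Nullary using (Dec; yes; no; ¬_)
open import Relation.Nullary.Decidable using (_×-dec_)
open import Data.List.Relation.Unary.All using (all?)

-- Points of ℚ^n (rational stand-in for ℝ^n)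
Pt : ℕ → Set
Pt n = Fin n → ℚ

sumFin : ∀ {n} → (Fin n → ℚ) → ℚ
sumFin {zero}  g = 0ℚ
sumFin {suc n} g = g zero + sumFin (λ i → g (suc i))

dot : ∀ {n} → Pt n → Pt n → ℚ
dot ℓ x = sumFin (λ i → ℓ i * x i)

InV0 : ∀ {n} → Pt n → Set
InV0 x = sumFin x ≡ 0ℚ

inV0? : ∀ {n} (x : Pt n) → Dec (InV0 x)
inV0? x = sumFin x ≟ 0ℚ

χ : ∀ {P : Set} → Dec P → ℚ
χ (yes _) = 1ℚ
χ (no _)  = 0ℚ

-- Polyhedral cones in V_0^n: { x ∈ V_0^n : a·x ≥ 0 for every a in the list }
-- (equations a·x = 0 are encoded as the two inequalities a·x ≥ 0, (-a)·x ≥ 0)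

Cone : ℕ → Set
Cone n = List (Pt n)

InCone : ∀ {n} → Cone n → Pt n → Set
InCone C x = InV0 x × All (λ a → 0ℚ ≤ dot a x) C

inCone? : ∀ {n} (C : Cone n) (x : Pt n) → Dec (InCone C x)
inCone? C x = inV0? x ×-dec all? (λ a → 0ℚ ≤? dot a x) C

-- codimension ≥ 1 in V_0^n: the cone lies in a hyperplane of V_0^n, i.e. it is
-- annihilated by a linear functional ℓ that does not vanish on V_0^n
-- (equivalently ℓ is not a multiple of (1,…,1), i.e. ℓ is non-constant).
Codim≥1 : ∀ {n} → Cone n → Set
Codim≥1 {n} C =
  Σ (Pt n) λ ℓ → (Σ (Fin n) λ i → Σ (Fin n) λ j → ℓ i ≢ ℓ j)
               × (∀ x → InCone C x → dot ℓ x ≡ 0ℚ)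

combo : ∀ {n} → List (ℚ × Cone n) → Pt n → ℚ
combo []             x = 0ℚ
combo ((c , C) ∷ cs) x = c * χ (inCone? C x) + combo cs x

-- Ordered set partitions (S_1,…,S_k) of {1,…,n} with k = suc k' blocks,
-- encoded by the surjective block map f : Fin n → Fin k (S_j = f⁻¹(j)).

IsSurj : ∀ {n k} → (Fin n → Fin k) → Set
IsSurj {n} {k} f = ∀ (j : Fin k) → Σ (Fin n) λ i → f i ≡ j

-- Position (0-based) of block j in the r-th cyclic rotation
-- (S_{r+1},…,S_k,S_1,…,S_r), for r < k:  (j - r) mod k.
rotPos : (k r j : ℕ) → ℕ
rotPos zero    r j = 0
rotPos (suc k) r j = (j ℕ.+ (suc k ∸ r)) % suc k

-- x_{T_1 ∪ … ∪ T_m} where (T_1,…,T_k) is the r-th rotation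
prefixSum : ∀ {n k} → (Fin n → Fin k) → ℕ → ℕ → Pt n → ℚ
prefixSum {n} {k} f r m x =
  sumFin (λ i → χ (rotPos k r (toℕ (f i)) ℕ.<? m) * x i)

prefixIndices : ℕ → List ℕ
prefixIndices k = map suc (upTo (k ∸ 1))

InPlateRot : ∀ {n k} → (Fin n → Fin k) → ℕ → Pt n → Set
InPlateRot {n} {k} f r x =
  InV0 x × All (λ m → 0ℚ ≤ prefixSum f r m x) (prefixIndices k)

inPlateRot? : ∀ {n k} (f : Fin n → Fin k) (r : ℕ) (x : Pt n) → Dec (InPlateRot f r x)
inPlateRot? {n} {k} f r x =
  inV0? x ×-dec all? (λ m → 0ℚ ≤? prefixSum f r m x) (prefixIndices k)

rotationSum : ∀ {n k} → (Fin n → Fin k) → Pt n → ℚ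
rotationSum {n} {k} f x = sumFin (λ (r : Fin k) → χ (inPlateRot? f (toℕ r) x))

{-# OPTIONS --safe #-}
-- For x ∈ V₀ write Q t = x_{S₁ ∪ ⋯ ∪ S_t}. The partial sums of the r-th rotation are the cyclic
-- differences Q ((r + m) mod k) − Q r, so x lies in the r-th rotated plate iff Q r is minimal among
-- Q 0, …, Q (k − 1). Hence the rotated plates cover V₀ (rotate to a minimiser), and the plates of
-- rotations j ≠ r meet inside the hyperplane Q r = Q j, which is proper because no block is empty.
-- With P_r the r-th rotated plate, inclusion–exclusion then writes Σ_r [[P_r]] − [[⋃_r P_r]] as a
-- combination of indicators of cones lying in some P_j ∩ P_r, all of codimension ≥ 1.
module Submission where

open import Defs
open import Data.Nat using (ℕ; suc)
open import Data.Fin using (Fin)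
open import Data.Rational using (ℚ; _+_)
open import Data.List using (List)
open import Data.List.Relation.Unary.All using (All)
open import Data.Product using (Σ; _×_; proj₂)
open import Relation.Binary.PropositionalEquality using (_≡_)

open import Algebra.Bundles using (CommutativeMonoid)
open import Data.Nat as ℕ using (zero; _∸_; _%_; _<_; _≤_; _<?_; z<s; s<s)
import Data.Nat.Properties as ℕₚ
open import Data.Nat.DivMod
  using (m<n⇒m%n≡m; m%n<n; m%n%n≡m%n; %-distribˡ-+; [m+n]%n≡m%n; m≤n⇒[n∸m]%m≡n%m)
open import Data.Fin as Fin using (toℕ; fromℕ<)
open import Data.Fin.Properties using (toℕ<n; toℕ-fromℕ<)
open import Data.Vec.Functional using (tail)
import Data.Rational as ℚ
open import Data.Rational using (0ℚ; 1ℚ; _*_; -_; _-_)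
import Data.Rational.Properties as ℚₚ
open import Data.Rational.Solver using (module +-*-Solver)
open import Data.List using ([]; _∷_; _++_; map; allFin)
open import Data.List.Relation.Unary.All using ([]; _∷_; lookup; tabulate) renaming (map to All-map)
import Data.List.Relation.Unary.All.Properties as Allₚ
open import Data.List.Membership.Propositional.Properties using (∈-upTo⁺; ∈-upTo⁻; ∈-allFin)
open import Data.Product using (_,_; proj₁; map₁; map₂)
open import Function using (_∘_; _⇔_; mk⇔; Equivalence)
open import Relation.Binary.Bundles using (DecTotalOrder)
open import Relation.Binary.PropositionalEquality
  using (refl; sym; trans; cong; cong₂; subst; subst₂; _≢_; module ≡-Reasoning)
open import Relation.Nullary using (Dec; yes; no; ¬_; contradiction)

open import Algebra.Properties.CommutativeSemigroup ℕₚ.+-commutativeSemigroup using (x∙yz≈y∙xz)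
open import Algebra.Properties.CommutativeSemigroup
  (CommutativeMonoid.commutativeSemigroup ℚₚ.+-0-commutativeMonoid) using (interchange)
open import Data.List.Extrema (DecTotalOrder.totalOrder ℚₚ.≤-decTotalOrder) using (argmin; f[argmin]≤f[xs])
open +-*-Solver using (solve; _:=_; _:+_; _:-_; _:*_; con)
open ≡-Reasoning

m+n<o⇔m<o∸n : ∀ {m n o} → m ℕ.+ n < o ⇔ m < o ∸ n
m+n<o⇔m<o∸n {m} {n} {o} = mk⇔ (ℕₚ.m+n≤o⇒m≤o∸n (suc m)) from
  where
  from : m < o ∸ n → m ℕ.+ n < o
  from m<o∸n = ℕₚ.m≤o∸n⇒m+n≤o (suc m) (ℕₚ.<⇒≤ n<o) m<o∸n
    where n<o = ℕₚ.m∸n≢0⇒n<m (λ o∸n≡0 → ℕₚ.n≮0 (subst (m <_) o∸n≡0 m<o∸n))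

module _ {k : ℕ} where

  private
    K = suc k

  rotPos-below : ∀ {r b} → b < r → r ≤ K → rotPos K r b ≡ b ℕ.+ (K ∸ r)
  rotPos-below {r} {b} b<r r≤K = m<n⇒m%n≡m
    (subst (b ℕ.+ (K ∸ r) <_) (ℕₚ.m+[n∸m]≡n r≤K) (ℕₚ.+-monoˡ-< (K ∸ r) b<r))

  rotPos-above : ∀ {r b} → r ≤ b → b < K → rotPos K r b ≡ b ∸ r
  rotPos-above {r} {b} r≤b b<K = begin
    (b ℕ.+ (K ∸ r)) % K ≡⟨ cong (_% K) (trans (sym (ℕₚ.+-∸-assoc b r≤K))
                                              (ℕₚ.+-∸-comm K r≤b)) ⟩
    (b ∸ r ℕ.+ K) % K   ≡⟨ [m+n]%n≡m%n (b ∸ r) K ⟩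
    (b ∸ r) % K         ≡⟨ m<n⇒m%n≡m (ℕₚ.≤-<-trans (ℕₚ.m∸n≤m b r) b<K) ⟩
    b ∸ r               ∎
    where r≤K = ℕₚ.≤-trans r≤b (ℕₚ.<⇒≤ b<K)

  rotPos-arrives : ∀ {r t} → r ≤ K → t < K → (r ℕ.+ rotPos K r t) % K ≡ t
  rotPos-arrives {r} {t} r≤K t<K = begin
    (r ℕ.+ s % K) % K         ≡⟨ %-distribˡ-+ r (s % K) K ⟩
    (r % K ℕ.+ s % K % K) % K ≡⟨ cong (λ u → (r % K ℕ.+ u) % K) (m%n%n≡m%n s K) ⟩
    (r % K ℕ.+ s % K) % K     ≡⟨ %-distribˡ-+ r s K ⟨
    (r ℕ.+ s) % K             ≡⟨ cong (_% K) (x∙yz≈y∙xz r t (K ∸ r)) ⟩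
    (t ℕ.+ (r ℕ.+ (K ∸ r))) % K ≡⟨ cong (λ u → (t ℕ.+ u) % K) (ℕₚ.m+[n∸m]≡n r≤K) ⟩
    (t ℕ.+ K) % K             ≡⟨ [m+n]%n≡m%n t K ⟩
    t % K                     ≡⟨ m<n⇒m%n≡m t<K ⟩
    t                         ∎
    where s = t ℕ.+ (K ∸ r)

p≤q⇒0≤q-p : ∀ {p q} → p ℚ.≤ q → 0ℚ ℚ.≤ q - p
p≤q⇒0≤q-p {p} {q} p≤q = subst (ℚ._≤ q - p) (ℚₚ.+-inverseʳ p) (ℚₚ.+-monoˡ-≤ (- p) p≤q)

0≤q-p⇒p≤q : ∀ {p q} → 0ℚ ℚ.≤ q - p → p ℚ.≤ q
0≤q-p⇒p≤q {p} {q} 0≤q-p = subst₂ ℚ._≤_ (ℚₚ.+-identityˡ p) q-p+p≡q (ℚₚ.+-monoˡ-≤ p 0≤q-p)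
  where q-p+p≡q = solve 2 (λ p q → q :- p :+ p := q) refl p q

χ-yes : ∀ {P : Set} → P → (p? : Dec P) → χ p? ≡ 1ℚ
χ-yes p (yes _) = refl
χ-yes p (no ¬p) = contradiction p ¬p

χ-no : ∀ {P : Set} → ¬ P → (p? : Dec P) → χ p? ≡ 0ℚ
χ-no ¬p (yes p) = contradiction p ¬p
χ-no ¬p (no _)  = refl

χ-cong : ∀ {P Q : Set} → P ⇔ Q → (p? : Dec P) (q? : Dec Q) → χ p? ≡ χ q?
χ-cong P⇔Q p? (yes q) = χ-yes (Equivalence.from P⇔Q q) p?
χ-cong P⇔Q p? (no ¬q) = χ-no (¬q ∘ Equivalence.to P⇔Q) p?

sumFin-cong : ∀ {n} {g h : Fin n → ℚ} → (∀ i → g i ≡ h i) → sumFin g ≡ sumFin h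
sumFin-cong {zero}  g≗h = refl
sumFin-cong {suc n} g≗h = cong₂ _+_ (g≗h Fin.zero) (sumFin-cong (g≗h ∘ Fin.suc))

sumFin-0 : ∀ {n} → sumFin {n} (λ _ → 0ℚ) ≡ 0ℚ
sumFin-0 {zero}  = refl
sumFin-0 {suc n} = trans (ℚₚ.+-identityˡ _) (sumFin-0 {n})

sumFin-+ : ∀ {n} (g h : Fin n → ℚ) → sumFin (λ i → g i + h i) ≡ sumFin g + sumFin h
sumFin-+ {zero}  g h = refl
sumFin-+ {suc n} g h = begin
  g₀ + h₀ + sumFin (λ i → tail g i + tail h i)  ≡⟨ cong (g₀ + h₀ +_) (sumFin-+ (tail g) (tail h)) ⟩
  g₀ + h₀ + (sumFin (tail g) + sumFin (tail h)) ≡⟨ interchange g₀ h₀ (sumFin (tail g)) (sumFin (tail h)) ⟩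
  g₀ + sumFin (tail g) + (h₀ + sumFin (tail h)) ∎
  where
  g₀ = g Fin.zero
  h₀ = h Fin.zero

sumFin-neg : ∀ {n} (g : Fin n → ℚ) → sumFin (λ i → - g i) ≡ - sumFin g
sumFin-neg {zero}  g = refl
sumFin-neg {suc n} g = trans (cong (- g Fin.zero +_) (sumFin-neg (tail g)))
                             (sym (ℚₚ.neg-distrib-+ (g Fin.zero) (sumFin (tail g))))

dot-+ : ∀ {n} (a b x : Pt n) → dot (λ i → a i + b i) x ≡ dot a x + dot b x
dot-+ a b x = trans (sumFin-cong (λ i → ℚₚ.*-distribʳ-+ (x i) (a i) (b i)))
                    (sumFin-+ (λ i → a i * x i) (λ i → b i * x i))

dot-- : ∀ {n} (a b x : Pt n) → dot (λ i → a i - b i) x ≡ dot a x - dot b x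
dot-- a b x = trans (dot-+ a (λ i → - b i) x) (cong (dot a x +_) dot-neg)
  where
  dot-neg = trans (sumFin-cong (λ i → sym (ℚₚ.neg-distribˡ-* (b i) (x i)))) (sumFin-neg (λ i → b i * x i))

All-prefixIndices⁺ : ∀ {k} {P : ℕ → Set} →
                     (∀ {m} → 0 < m → m < suc k → P m) → All P (prefixIndices (suc k))
All-prefixIndices⁺ P⁺ = Allₚ.map⁺ (tabulate λ t∈ → P⁺ z<s (s<s (∈-upTo⁻ t∈)))

All-prefixIndices⁻ : ∀ {k} {P : ℕ → Set} →
                     All P (prefixIndices (suc k)) → ∀ {m} → 0 < m → m < suc k → P m
All-prefixIndices⁻ Ps {suc t} _ 1+t<1+k = lookup (Allₚ.map⁻ Ps) (∈-upTo⁺ (ℕ.s<s⁻¹ 1+t<1+k))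

module _ {n : ℕ} where

  ⟦_⟧ : Cone n → Pt n → ℚ
  ⟦ C ⟧ x = χ (inCone? C x)

  InCone-++⁻ : ∀ (C D : Cone n) x → InCone (C ++ D) x → InCone C x × InCone D x
  InCone-++⁻ C D x (x∈V , C++D≥0) = map₂ (x∈V ,_) (map₁ (x∈V ,_) (Allₚ.++⁻ C C++D≥0))

  InCone-++⁺ : ∀ (C D : Cone n) x → InCone C x → InCone D x → InCone (C ++ D) x
  InCone-++⁺ C D x (x∈V , C≥0) (_ , D≥0) = x∈V , Allₚ.++⁺ C≥0 D≥0

  ⟦++⟧ : ∀ (C D : Cone n) x → ⟦ C ++ D ⟧ x ≡ ⟦ C ⟧ x * ⟦ D ⟧ x
  ⟦++⟧ C D x with inCone? C x | inCone? D x
  ... | yes x∈C | yes x∈D = χ-yes (InCone-++⁺ C D x x∈C x∈D) (inCone? (C ++ D) x)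
  ... | yes _   | no x∉D  = χ-no (x∉D ∘ proj₂ ∘ InCone-++⁻ C D x) (inCone? (C ++ D) x)
  ... | no x∉C  | yes _   = χ-no (x∉C ∘ proj₁ ∘ InCone-++⁻ C D x) (inCone? (C ++ D) x)
  ... | no x∉C  | no _    = χ-no (x∉C ∘ proj₁ ∘ InCone-++⁻ C D x) (inCone? (C ++ D) x)

  Codim≥1-++ : ∀ (C : Cone n) {D} → Codim≥1 D → Codim≥1 (C ++ D)
  Codim≥1-++ C (ℓ , nonconstant , ℓ⊥D) =
    ℓ , nonconstant , λ x → ℓ⊥D x ∘ proj₂ ∘ InCone-++⁻ C _ x

  Negligible : (Pt n → ℚ) → Set
  Negligible h = Σ (List (ℚ × Cone n)) λ L →
    All (λ p → Codim≥1 (proj₂ p)) L × (∀ x → h x ≡ combo L x)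

  Negligible-cong : ∀ {h h′} → (∀ x → h x ≡ h′ x) → Negligible h → Negligible h′
  Negligible-cong h≗h′ (L , codim , h≗L) = L , codim , λ x → trans (sym (h≗h′ x)) (h≗L x)

  Negligible-0 : Negligible (λ _ → 0ℚ)
  Negligible-0 = [] , [] , λ _ → refl

  Negligible-⟦⟧ : ∀ {C} → Codim≥1 C → Negligible ⟦ C ⟧
  Negligible-⟦⟧ {C} codim = (1ℚ , C) ∷ [] , codim ∷ [] ,
    λ x → sym (trans (ℚₚ.+-identityʳ _) (ℚₚ.*-identityˡ (⟦ C ⟧ x)))

  Negligible-+ : ∀ {h₁ h₂} → Negligible h₁ → Negligible h₂ → Negligible (λ x → h₁ x + h₂ x)
  Negligible-+ (L , codimL , h₁≗L) (M , codimM , h₂≗M) =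
    L ++ M , Allₚ.++⁺ codimL codimM , λ x → trans (cong₂ _+_ (h₁≗L x) (h₂≗M x)) (sym (combo-++ L x))
    where
    combo-++ : ∀ L x → combo (L ++ M) x ≡ combo L x + combo M x
    combo-++ []            x = sym (ℚₚ.+-identityˡ (combo M x))
    combo-++ ((c , D) ∷ L) x = trans (cong (c * ⟦ D ⟧ x +_) (combo-++ L x))
                                     (sym (ℚₚ.+-assoc (c * ⟦ D ⟧ x) (combo L x) (combo M x)))

  Negligible-neg : ∀ {h} → Negligible h → Negligible (λ x → - h x)
  Negligible-neg (L , codim , h≗L) =
    map negate L , Allₚ.map⁺ codim , λ x → trans (cong -_ (h≗L x)) (sym (combo-neg L x))
    where
    negate : ℚ × Cone n → ℚ × Cone n
    negate = map₁ (λ c → - c)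
    combo-neg : ∀ L x → combo (map negate L) x ≡ - combo L x
    combo-neg []            x = refl
    combo-neg ((c , D) ∷ L) x = begin
      - c * ⟦ D ⟧ x + combo (map negate L) x
        ≡⟨ cong₂ _+_ (sym (ℚₚ.neg-distribˡ-* c (⟦ D ⟧ x))) (combo-neg L x) ⟩
      - (c * ⟦ D ⟧ x) + - combo L x
        ≡⟨ ℚₚ.neg-distrib-+ (c * ⟦ D ⟧ x) (combo L x) ⟨
      - (c * ⟦ D ⟧ x + combo L x) ∎

  Negligible-⟦⟧* : ∀ (C : Cone n) {h} → Negligible h → Negligible (λ x → ⟦ C ⟧ x * h x)
  Negligible-⟦⟧* C (L , codim , h≗L) =
    map (map₂ (C ++_)) L , Allₚ.map⁺ (All-map (Codim≥1-++ C) codim) ,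
    λ x → trans (cong (⟦ C ⟧ x *_) (h≗L x)) (sym (combo-⟦⟧* L x))
    where
    combo-⟦⟧* : ∀ L x → combo (map (map₂ (C ++_)) L) x ≡ ⟦ C ⟧ x * combo L x
    combo-⟦⟧* []            x = sym (ℚₚ.*-zeroʳ (⟦ C ⟧ x))
    combo-⟦⟧* ((c , D) ∷ L) x = begin
      c * ⟦ C ++ D ⟧ x + combo (map (map₂ (C ++_)) L) x
        ≡⟨ cong₂ (λ u v → c * u + v) (⟦++⟧ C D x) (combo-⟦⟧* L x) ⟩
      c * (⟦ C ⟧ x * ⟦ D ⟧ x) + ⟦ C ⟧ x * combo L x
        ≡⟨ solve 4 (λ c a b l → c :* (a :* b) :+ a :* l := a :* (c :* b :+ l)) refl
                   c (⟦ C ⟧ x) (⟦ D ⟧ x) (combo L x) ⟩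
      ⟦ C ⟧ x * (c * ⟦ D ⟧ x + combo L x) ∎

  Σ⟦_⟧ : ∀ {K} → (Fin K → Cone n) → Pt n → ℚ
  Σ⟦ g ⟧ x = sumFin (λ r → ⟦ g r ⟧ x)

  ⟦⋃_⟧ : ∀ {K} → (Fin K → Cone n) → Pt n → ℚ
  ⟦⋃_⟧ {zero}  g x = 0ℚ
  ⟦⋃_⟧ {suc K} g x = ⟦ g Fin.zero ⟧ x + ⟦⋃ tail g ⟧ x - ⟦ g Fin.zero ⟧ x * ⟦⋃ tail g ⟧ x

  ⟦⋃⟧-∈ : ∀ {K} (g : Fin K → Cone n) {x} r → InCone (g r) x → ⟦⋃ g ⟧ x ≡ 1ℚ
  ⟦⋃⟧-∈ g {x} Fin.zero x∈g₀ = begin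
    c + u - c * u   ≡⟨ cong (λ c → c + u - c * u) (χ-yes x∈g₀ (inCone? (g Fin.zero) x)) ⟩
    1ℚ + u - 1ℚ * u ≡⟨ solve 1 (λ u → con 1ℚ :+ u :- con 1ℚ :* u := con 1ℚ) refl u ⟩
    1ℚ              ∎
    where
    c = ⟦ g Fin.zero ⟧ x
    u = ⟦⋃ tail g ⟧ x
  ⟦⋃⟧-∈ g {x} (Fin.suc r) x∈gᵣ = begin
    c + u - c * u   ≡⟨ cong (λ u → c + u - c * u) (⟦⋃⟧-∈ (tail g) r x∈gᵣ) ⟩
    c + 1ℚ - c * 1ℚ ≡⟨ solve 1 (λ c → c :+ con 1ℚ :- c :* con 1ℚ := con 1ℚ) refl c ⟩
    1ℚ              ∎
    where
    c = ⟦ g Fin.zero ⟧ x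
    u = ⟦⋃ tail g ⟧ x

  ⟦⋃⟧-∉ : ∀ {K} (g : Fin K → Cone n) {x} → (∀ r → ¬ InCone (g r) x) → ⟦⋃ g ⟧ x ≡ 0ℚ
  ⟦⋃⟧-∉ {zero}  g x∉g = refl
  ⟦⋃⟧-∉ {suc K} g {x} x∉g = cong₂ (λ c u → c + u - c * u)
    (χ-no (x∉g Fin.zero) (inCone? (g Fin.zero) x)) (⟦⋃⟧-∉ (tail g) (x∉g ∘ Fin.suc))

  CoversV₀ : ∀ {K} → (Fin K → Cone n) → Set
  CoversV₀ {K} g = ∀ x → InV0 x → Σ (Fin K) λ r → InCone (g r) x

  ⟦⋃⟧≡χV₀ : ∀ {K} (g : Fin K → Cone n) → CoversV₀ g → ∀ x → ⟦⋃ g ⟧ x ≡ χ (inV0? x)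
  ⟦⋃⟧≡χV₀ g cover x with inV0? x
  ... | yes x∈V = let r , x∈gᵣ = cover x x∈V in ⟦⋃⟧-∈ g r x∈gᵣ
  ... | no x∉V  = ⟦⋃⟧-∉ g (λ r → x∉V ∘ proj₁)

  Negligible-⟦⟧*⟦⋃⟧ : ∀ (C : Cone n) {K} (g : Fin K → Cone n) → (∀ r → Codim≥1 (C ++ g r)) →
                      Negligible (λ x → ⟦ C ⟧ x * ⟦⋃ g ⟧ x)
  Negligible-⟦⟧*⟦⋃⟧ C {zero}  g codim =
    Negligible-cong (λ x → sym (ℚₚ.*-zeroʳ (⟦ C ⟧ x))) Negligible-0
  Negligible-⟦⟧*⟦⋃⟧ C {suc K} g codim = Negligible-cong expand
    (Negligible-+ (Negligible-+ (Negligible-⟦⟧ (codim Fin.zero)) C∩⋃tail)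
                  (Negligible-neg (Negligible-⟦⟧* (g Fin.zero) C∩⋃tail)))
    where
    C∩⋃tail = Negligible-⟦⟧*⟦⋃⟧ C (tail g) (codim ∘ Fin.suc)
    expand : ∀ x → ⟦ C ++ g Fin.zero ⟧ x + ⟦ C ⟧ x * ⟦⋃ tail g ⟧ x
                     + - (⟦ g Fin.zero ⟧ x * (⟦ C ⟧ x * ⟦⋃ tail g ⟧ x))
                 ≡ ⟦ C ⟧ x * ⟦⋃ g ⟧ x
    expand x = begin
      ⟦ C ++ g Fin.zero ⟧ x + a * u - c * (a * u)
        ≡⟨ cong (λ v → v + a * u - c * (a * u)) (⟦++⟧ C (g Fin.zero) x) ⟩
      a * c + a * u - c * (a * u)
        ≡⟨ solve 3 (λ a c u → a :* c :+ a :* u :- c :* (a :* u) := a :* (c :+ u :- c :* u)) refl a c u ⟩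
      a * (c + u - c * u) ∎
      where
      a = ⟦ C ⟧ x
      c = ⟦ g Fin.zero ⟧ x
      u = ⟦⋃ tail g ⟧ x

  PairwiseCodim≥1 : ∀ {K} → (Fin K → Cone n) → Set
  PairwiseCodim≥1 g = ∀ {j r} → j Fin.< r → Codim≥1 (g j ++ g r)

  Negligible-Σ⟦⟧-⟦⋃⟧ : ∀ {K} (g : Fin K → Cone n) → PairwiseCodim≥1 g →
                       Negligible (λ x → Σ⟦ g ⟧ x - ⟦⋃ g ⟧ x)
  Negligible-Σ⟦⟧-⟦⋃⟧ {zero}  g pairwise = Negligible-0
  Negligible-Σ⟦⟧-⟦⋃⟧ {suc K} g pairwise = Negligible-cong regroup
    (Negligible-+ (Negligible-Σ⟦⟧-⟦⋃⟧ (tail g) (pairwise ∘ s<s))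
                  (Negligible-⟦⟧*⟦⋃⟧ (g Fin.zero) (tail g) (λ r → pairwise z<s)))
    where
    regroup : ∀ x → Σ⟦ tail g ⟧ x - ⟦⋃ tail g ⟧ x + ⟦ g Fin.zero ⟧ x * ⟦⋃ tail g ⟧ x
                  ≡ Σ⟦ g ⟧ x - ⟦⋃ g ⟧ x
    regroup x = solve 3 (λ c s u → s :- u :+ c :* u := c :+ s :- (c :+ u :- c :* u)) refl
                  (⟦ g Fin.zero ⟧ x) (Σ⟦ tail g ⟧ x) (⟦⋃ tail g ⟧ x)

  Σ⟦⟧≡χV₀+combo : ∀ {K} (g : Fin K → Cone n) → PairwiseCodim≥1 g → CoversV₀ g →
                  Σ (List (ℚ × Cone n)) λ L → All (λ p → Codim≥1 (proj₂ p)) L ×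
                    (∀ x → Σ⟦ g ⟧ x ≡ χ (inV0? x) + combo L x)
  Σ⟦⟧≡χV₀+combo g pairwise cover =
    let L , codim , Σ-⋃≗L = Negligible-Σ⟦⟧-⟦⋃⟧ g pairwise in
    L , codim , λ x → begin
      Σ⟦ g ⟧ x                         ≡⟨ solve 2 (λ s u → s := u :+ (s :- u)) refl (Σ⟦ g ⟧ x) (⟦⋃ g ⟧ x) ⟩
      ⟦⋃ g ⟧ x + (Σ⟦ g ⟧ x - ⟦⋃ g ⟧ x) ≡⟨ cong₂ _+_ (⟦⋃⟧≡χV₀ g cover x) (Σ-⋃≗L x) ⟩
      χ (inV0? x) + combo L x          ∎

module Plates {n k : ℕ} (f : Fin n → Fin (suc k)) where

  private
    K = suc k

  -- x_{S₁ ∪ ⋯ ∪ S_t}, where f numbers the blocks from 0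
  sumBelow : ℕ → Pt n → ℚ
  sumBelow t x = sumFin (λ i → χ (toℕ (f i) <? t) * x i)

  sumBelow-0 : ∀ x → sumBelow 0 x ≡ 0ℚ
  sumBelow-0 x = trans (sumFin-cong (λ i → ℚₚ.*-zeroˡ (x i))) (sumFin-0 {n})

  sumBelow-V₀ : ∀ {t x} → K ≤ t → InV0 x → sumBelow t x ≡ 0ℚ
  sumBelow-V₀ {t} {x} K≤t x∈V = trans (sumFin-cong all-below) x∈V
    where
    all-below : ∀ i → χ (toℕ (f i) <? t) * x i ≡ x i
    all-below i = trans (cong (_* x i) (χ-yes (ℕₚ.<-≤-trans (toℕ<n (f i)) K≤t) (toℕ (f i) <? t)))
                        (ℚₚ.*-identityˡ (x i))

  χ-rotPos<? : ∀ {r m b} → r < K → m ≤ K → b < K →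
               χ (rotPos K r b <? m) ≡ χ (b <? r ℕ.+ m) - χ (b <? r) + χ (b <? r ℕ.+ m ∸ K)
  χ-rotPos<? {r} {m} {b} r<K m≤K b<K with b <? r
  ... | yes b<r = begin
    χ (rotPos K r b <? m)          ≡⟨ cong (χ ∘ (_<? m)) (rotPos-below b<r (ℕₚ.<⇒≤ r<K)) ⟩
    χ (b ℕ.+ (K ∸ r) <? m)         ≡⟨ χ-cong wraps-around (b ℕ.+ (K ∸ r) <? m) (b <? r ℕ.+ m ∸ K) ⟩
    χ (b <? r ℕ.+ m ∸ K)           ≡⟨ solve 1 (λ z → z := con 1ℚ :- con 1ℚ :+ z) refl _ ⟩
    1ℚ - 1ℚ + χ (b <? r ℕ.+ m ∸ K) ≡⟨ cong (λ c → c - 1ℚ + χ (b <? r ℕ.+ m ∸ K))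
                                          (χ-yes (ℕₚ.<-≤-trans b<r (ℕₚ.m≤m+n r m)) (b <? r ℕ.+ m)) ⟨
    χ (b <? r ℕ.+ m) - 1ℚ + χ (b <? r ℕ.+ m ∸ K) ∎
    where
    r+m∸K≡m∸[K∸r] : r ℕ.+ m ∸ K ≡ m ∸ (K ∸ r)
    r+m∸K≡m∸[K∸r] = trans (cong (r ℕ.+ m ∸_) (sym (ℕₚ.m+[n∸m]≡n (ℕₚ.<⇒≤ r<K))))
                          (ℕₚ.[m+n]∸[m+o]≡n∸o r m (K ∸ r))
    wraps-around : b ℕ.+ (K ∸ r) < m ⇔ b < r ℕ.+ m ∸ K
    wraps-around = subst (λ s → b ℕ.+ (K ∸ r) < m ⇔ b < s) (sym r+m∸K≡m∸[K∸r]) m+n<o⇔m<o∸n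
  ... | no b≮r = begin
    χ (rotPos K r b <? m)      ≡⟨ cong (χ ∘ (_<? m)) (rotPos-above r≤b b<K) ⟩
    χ (b ∸ r <? m)             ≡⟨ χ-cong stays (b ∸ r <? m) (b <? r ℕ.+ m) ⟩
    χ (b <? r ℕ.+ m)           ≡⟨ solve 1 (λ z → z := z :- con 0ℚ :+ con 0ℚ) refl _ ⟩
    χ (b <? r ℕ.+ m) - 0ℚ + 0ℚ ≡⟨ cong (χ (b <? r ℕ.+ m) - 0ℚ +_)
                                      (χ-no b≮r+m∸K (b <? r ℕ.+ m ∸ K)) ⟨
    χ (b <? r ℕ.+ m) - 0ℚ + χ (b <? r ℕ.+ m ∸ K) ∎
    where
    r≤b = ℕₚ.≮⇒≥ b≮r
    stays : b ∸ r < m ⇔ b < r ℕ.+ m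
    stays = mk⇔ (λ b∸r<m → subst (_< r ℕ.+ m) (ℕₚ.m+[n∸m]≡n r≤b) (ℕₚ.+-monoʳ-< r b∸r<m))
                (λ b<r+m → subst (b ∸ r <_) (ℕₚ.m+n∸m≡n r m) (ℕₚ.∸-monoˡ-< b<r+m r≤b))
    b≮r+m∸K : ¬ b < r ℕ.+ m ∸ K
    b≮r+m∸K = ℕₚ.≤⇒≯ (ℕₚ.≤-trans r+m∸K≤r r≤b)
      where
      r+m∸K≤r = ℕₚ.≤-trans (ℕₚ.∸-monoˡ-≤ K (ℕₚ.+-monoʳ-≤ r m≤K))
                           (ℕₚ.≤-reflexive (ℕₚ.m+n∸n≡m r K))

  prefixSum≡ : ∀ {r m} x → r < K → m ≤ K →
               prefixSum f r m x ≡ sumBelow (r ℕ.+ m) x - sumBelow r x + sumBelow (r ℕ.+ m ∸ K) x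
  prefixSum≡ {r} {m} x r<K m≤K = begin
    prefixSum f r m x                 ≡⟨ sumFin-cong (λ i → cong (_* x i)
                                                   (χ-rotPos<? r<K m≤K (toℕ<n (f i)))) ⟩
    dot (λ i → a i - b i + c i) x     ≡⟨ dot-+ (λ i → a i - b i) c x ⟩
    dot (λ i → a i - b i) x + dot c x ≡⟨ cong (_+ dot c x) (dot-- a b x) ⟩
    dot a x - dot b x + dot c x       ∎
    where
    a b c : Pt n
    a i = χ (toℕ (f i) <? r ℕ.+ m)
    b i = χ (toℕ (f i) <? r)
    c i = χ (toℕ (f i) <? r ℕ.+ m ∸ K)

  prefixSum-cyclic : ∀ {r m x} → InV0 x → r < K → m < K →
                     prefixSum f r m x ≡ sumBelow ((r ℕ.+ m) % K) x - sumBelow r x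
  prefixSum-cyclic {r} {m} {x} x∈V r<K m<K with r ℕ.+ m <? K
  ... | yes r+m<K = begin
    prefixSum f r m x                             ≡⟨ prefixSum≡ x r<K (ℕₚ.<⇒≤ m<K) ⟩
    Q (r ℕ.+ m) - Q r + Q (r ℕ.+ m ∸ K)           ≡⟨ cong (λ t → Q (r ℕ.+ m) - Q r + Q t)
                                                          (ℕₚ.m≤n⇒m∸n≡0 (ℕₚ.<⇒≤ r+m<K)) ⟩
    Q (r ℕ.+ m) - Q r + Q 0                       ≡⟨ cong (Q (r ℕ.+ m) - Q r +_) (sumBelow-0 x) ⟩
    Q (r ℕ.+ m) - Q r + 0ℚ                        ≡⟨ ℚₚ.+-identityʳ _ ⟩
    Q (r ℕ.+ m) - Q r                             ≡⟨ cong (λ t → Q t - Q r) (m<n⇒m%n≡m r+m<K) ⟨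
    Q ((r ℕ.+ m) % K) - Q r                       ∎
    where Q = λ t → sumBelow t x
  ... | no r+m≮K = begin
    prefixSum f r m x                             ≡⟨ prefixSum≡ x r<K (ℕₚ.<⇒≤ m<K) ⟩
    Q (r ℕ.+ m) - Q r + Q (r ℕ.+ m ∸ K)           ≡⟨ cong (λ q → q - Q r + Q (r ℕ.+ m ∸ K))
                                                          (sumBelow-V₀ K≤r+m x∈V) ⟩
    0ℚ - Q r + Q (r ℕ.+ m ∸ K)                    ≡⟨ solve 2 (λ p q → con 0ℚ :- p :+ q := q :- p) refl
                                                           (Q r) (Q (r ℕ.+ m ∸ K)) ⟩
    Q (r ℕ.+ m ∸ K) - Q r                         ≡⟨ cong (λ t → Q t - Q r) r+m∸K≡[r+m]%K ⟩
    Q ((r ℕ.+ m) % K) - Q r                       ∎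
    where
    Q = λ t → sumBelow t x
    K≤r+m = ℕₚ.≮⇒≥ r+m≮K
    r+m∸K≡[r+m]%K : r ℕ.+ m ∸ K ≡ (r ℕ.+ m) % K
    r+m∸K≡[r+m]%K = trans (sym (m<n⇒m%n≡m (ℕₚ.m<n+o⇒m∸n<o (r ℕ.+ m) K (ℕₚ.+-mono-< r<K m<K))))
                          (m≤n⇒[n∸m]%m≡n%m K≤r+m)

  plateCone : ℕ → Cone n
  plateCone r = map (λ m i → χ (rotPos K r (toℕ (f i)) <? m)) (prefixIndices K)

  InPlateRot⇔InCone : ∀ r x → InPlateRot f r x ⇔ InCone (plateCone r) x
  InPlateRot⇔InCone r x = mk⇔ (map₂ Allₚ.map⁺) (map₂ Allₚ.map⁻)

  rotationSum≡Σ⟦plateCone⟧ : ∀ x → rotationSum f x ≡ Σ⟦ plateCone ∘ toℕ {K} ⟧ x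
  rotationSum≡Σ⟦plateCone⟧ x = sumFin-cong {K} λ r →
    χ-cong (InPlateRot⇔InCone (toℕ r) x) (inPlateRot? f (toℕ r) x) (inCone? (plateCone (toℕ r)) x)

  MinimalAt : ℕ → Pt n → Set
  MinimalAt r x = ∀ {t} → t < K → sumBelow r x ℚ.≤ sumBelow t x

  plateCone⇒minimal : ∀ {r x} → r < K → InCone (plateCone r) x → MinimalAt r x
  plateCone⇒minimal {r} {x} r<K (x∈V , arcs≥0) {t} t<K with t ℕ.≟ r
  ... | yes refl = ℚₚ.≤-refl
  ... | no t≢r   =
    0≤q-p⇒p≤q (subst (0ℚ ℚ.≤_) arc≡ (All-prefixIndices⁻ (Allₚ.map⁻ arcs≥0) 0<m m<K))
    where
    m = rotPos K r t
    m<K : m < K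
    m<K = m%n<n (t ℕ.+ (K ∸ r)) K
    arrives : (r ℕ.+ m) % K ≡ t
    arrives = rotPos-arrives (ℕₚ.<⇒≤ r<K) t<K
    0<m : 0 < m
    0<m = ℕₚ.n≢0⇒n>0 λ m≡0 → t≢r (begin
      t             ≡⟨ arrives ⟨
      (r ℕ.+ m) % K ≡⟨ cong (λ m → (r ℕ.+ m) % K) m≡0 ⟩
      (r ℕ.+ 0) % K ≡⟨ cong (_% K) (ℕₚ.+-identityʳ r) ⟩
      r % K         ≡⟨ m<n⇒m%n≡m r<K ⟩
      r             ∎)
    arc≡ : prefixSum f r m x ≡ sumBelow t x - sumBelow r x
    arc≡ = trans (prefixSum-cyclic x∈V r<K m<K) (cong (λ t → sumBelow t x - sumBelow r x) arrives)

  minimal⇒plateCone : ∀ {r x} → r < K → InV0 x → MinimalAt r x → InCone (plateCone r) x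
  minimal⇒plateCone {r} {x} r<K x∈V minimal = x∈V , Allₚ.map⁺ (All-prefixIndices⁺ arc≥0)
    where
    arc≥0 : ∀ {m} → 0 < m → m < K → 0ℚ ℚ.≤ prefixSum f r m x
    arc≥0 {m} _ m<K = subst (0ℚ ℚ.≤_) (sym (prefixSum-cyclic x∈V r<K m<K))
                            (p≤q⇒0≤q-p (minimal (m%n<n (r ℕ.+ m) K)))

  plateCones-cover : CoversV₀ (plateCone ∘ toℕ {K})
  plateCones-cover x x∈V = r , minimal⇒plateCone (toℕ<n r) x∈V minimal
    where
    Q : Fin K → ℚ
    Q t = sumBelow (toℕ t) x
    r : Fin K
    r = argmin Q Fin.zero (allFin K)
    minimal : MinimalAt (toℕ r) x
    minimal t<K = subst (λ t → sumBelow (toℕ r) x ℚ.≤ sumBelow t x) (toℕ-fromℕ< t<K)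
                    (lookup (f[argmin]≤f[xs] {f = Q} Fin.zero (allFin K)) (∈-allFin (fromℕ< t<K)))

  plateCones-pairwiseCodim≥1 : IsSurj f → PairwiseCodim≥1 (plateCone ∘ toℕ {K})
  plateCones-pairwiseCodim≥1 surj {j} {r} j<r = ℓ , (i₁ , i₂ , ℓi₁≢ℓi₂) , ℓ⊥
    where
    ℓ : Pt n
    ℓ i = χ (toℕ (f i) <? toℕ r) - χ (toℕ (f i) <? toℕ j)
    i₁ = proj₁ (surj j)
    i₂ = proj₁ (surj r)
    ℓ-on-block : ∀ {i s} → f i ≡ s → ℓ i ≡ χ (toℕ s <? toℕ r) - χ (toℕ s <? toℕ j)
    ℓ-on-block = cong (λ s → χ (toℕ s <? toℕ r) - χ (toℕ s <? toℕ j))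
    ℓi₁≡1 : ℓ i₁ ≡ 1ℚ
    ℓi₁≡1 = trans (ℓ-on-block (proj₂ (surj j)))
                  (cong₂ _-_ (χ-yes j<r (toℕ j <? toℕ r)) (χ-no (ℕₚ.n≮n (toℕ j)) (toℕ j <? toℕ j)))
    ℓi₂≡0 : ℓ i₂ ≡ 0ℚ
    ℓi₂≡0 = trans (ℓ-on-block (proj₂ (surj r)))
                  (cong₂ _-_ (χ-no (ℕₚ.n≮n (toℕ r)) (toℕ r <? toℕ r))
                             (χ-no (ℕₚ.<⇒≯ j<r) (toℕ r <? toℕ j)))
    ℓi₁≢ℓi₂ : ℓ i₁ ≢ ℓ i₂
    ℓi₁≢ℓi₂ ℓi₁≡ℓi₂ with () ← trans (sym ℓi₁≡1) (trans ℓi₁≡ℓi₂ ℓi₂≡0)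
    ℓ⊥ : ∀ x → InCone (plateCone (toℕ j) ++ plateCone (toℕ r)) x → dot ℓ x ≡ 0ℚ
    ℓ⊥ x x∈Pⱼ∩Pᵣ = begin
      dot ℓ x   ≡⟨ dot-- (λ i → χ (toℕ (f i) <? toℕ r)) (λ i → χ (toℕ (f i) <? toℕ j)) x ⟩
      Q r - Q j ≡⟨ cong (_- Q j) (ℚₚ.≤-antisym (plateCone⇒minimal (toℕ<n r) x∈Pᵣ (toℕ<n j))
                                               (plateCone⇒minimal (toℕ<n j) x∈Pⱼ (toℕ<n r))) ⟩
      Q j - Q j ≡⟨ ℚₚ.+-inverseʳ (Q j) ⟩
      0ℚ        ∎
      where
      Q = λ s → sumBelow (toℕ s) x
      x∈Pⱼ = proj₁ (InCone-++⁻ (plateCone (toℕ j)) (plateCone (toℕ r)) x x∈Pⱼ∩Pᵣ)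
      x∈Pᵣ = proj₂ (InCone-++⁻ (plateCone (toℕ j)) (plateCone (toℕ r)) x x∈Pⱼ∩Pᵣ)

corollary11 : (n k : ℕ) (f : Fin n → Fin (suc k)) → IsSurj f →
    Σ (List (ℚ × Cone n)) λ L →
      All (λ p → Codim≥1 (proj₂ p)) L ×
      (∀ (x : Pt n) → rotationSum f x ≡ χ (inV0? x) + combo L x)
corollary11 n k f surj =
  let L , codim , Σ⟦P⟧≡χV₀+L =
        Σ⟦⟧≡χV₀+combo (plateCone ∘ toℕ) (plateCones-pairwiseCodim≥1 surj) plateCones-cover
  in L , codim , λ x → trans (rotationSum≡Σ⟦plateCone⟧ x) (Σ⟦P⟧≡χV₀+L x)
  where open Plates f
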